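{- Every CIS split graph is $\cap$-edge simplicial.
   Context: A graph is CIS if every maximal clique and every maximal stable set intersect. A graph is split if its vertex set can be partitioned into a clique and a stable set. A clique $K$ is simplicial if $K=N[v]$ for some vertex $v$; a graph is edge simplicial if every edge lies in a simplicial clique; $G$ is $\cap$-edge simplicial if both $G$ and its complement $\overline{G}$ are edge simplicial. -}

module Defs where

open import Data.Nat using (ℕ)
open import Data.Fin using (Fin)
open import Data.Fin.Subset using (Subset; _∈_; _∉_; _⊆_)
open import Data.Bool using (Bool; true; false; not)
open import Data.Product using (Σ; ∃; _×_; _,_)
open import Data.Sum using (_⊎_)
open import Relation.Binary.PropositionalEquality using (_≡_; _≢_)
open import Relation.Nullary using (¬_)
open import Function.Bundles using (_⇔_)
open import Level using (0ℓ)

record Graph (n : ℕ) : Set where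
  field
    adj   : Fin n → Fin n → Bool
    sym   : ∀ u v → adj u v ≡ adj v u
    irrefl : ∀ v → adj v v ≡ false

open Graph public

Adj : ∀ {n} → Graph n → Fin n → Fin n → Set
Adj G u v = adj G u v ≡ true

module _ {n : ℕ} where
  open import Data.Fin using (_≟_)
  open import Relation.Nullary using (yes; no)
  open import Data.Bool using (if_then_else_)
  open import Relation.Binary.PropositionalEquality using (refl; cong)

  complAdj : Graph n → Fin n → Fin n → Bool
  complAdj G u v with u ≟ v
  ... | yes _ = false
  ... | no  _ = not (adj G u v)

  private
    complSym : (G : Graph n) → ∀ u v → complAdj G u v ≡ complAdj G v u
    complSym G u v with u ≟ v | v ≟ u
    ... | yes _ | yes _ = refl
    ... | yes refl | no q = Data.Empty.⊥-elim (q refl)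
      where import Data.Empty
    ... | no p | yes refl = Data.Empty.⊥-elim (p refl)
      where import Data.Empty
    ... | no _ | no _ = cong not (sym G u v)

    complIrr : (G : Graph n) → ∀ v → complAdj G v v ≡ false
    complIrr G v with v ≟ v
    ... | yes _ = refl
    ... | no p = Data.Empty.⊥-elim (p refl)
      where import Data.Empty

  complement : Graph n → Graph n
  complement G = record { adj = complAdj G ; sym = complSym G ; irrefl = complIrr G }

module _ {n : ℕ} (G : Graph n) where

  IsClique : Subset n → Set
  IsClique K = ∀ u v → u ∈ K → v ∈ K → u ≢ v → Adj G u v

  IsStable : Subset n → Set
  IsStable S = ∀ u v → u ∈ S → v ∈ S → ¬ Adj G u v

  IsMaximalClique : Subset n → Set
  IsMaximalClique K = IsClique K × (∀ K′ → IsClique K′ → K ⊆ K′ → K′ ⊆ K)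

  IsMaximalStable : Subset n → Set
  IsMaximalStable S = IsStable S × (∀ S′ → IsStable S′ → S ⊆ S′ → S′ ⊆ S)

  IsCIS : Set
  IsCIS = ∀ K S → IsMaximalClique K → IsMaximalStable S → ∃ λ v → v ∈ K × v ∈ S

  IsSplit : Set
  IsSplit = Σ (Subset n) λ K → Σ (Subset n) λ S →
              IsClique K × IsStable S ×
              (∀ v → v ∈ K ⊎ v ∈ S) × (∀ v → v ∈ K → v ∈ S → Data.Empty.⊥)
    where import Data.Empty

  InClosedNbhd : Fin n → Fin n → Set
  InClosedNbhd v u = u ≡ v ⊎ Adj G v u

  IsSimplicialClique : Subset n → Set
  IsSimplicialClique K = IsClique K × ∃ λ v → ∀ u → (u ∈ K) ⇔ InClosedNbhd v u

  IsEdgeSimplicial : Set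
  IsEdgeSimplicial = ∀ u v → Adj G u v →
    ∃ λ K → IsSimplicialClique K × u ∈ K × v ∈ K

IsCapEdgeSimplicial : ∀ {n} → Graph n → Set
IsCapEdgeSimplicial G = IsEdgeSimplicial G × IsEdgeSimplicial (complement G)

module Submission where

-- Fix a split partition V = K ⊔ S (K a clique, S a stable set).  The key
-- observation is that if every neighbour of a vertex w lies in K, then the
-- closed neighbourhood N[w] is a clique, hence a simplicial clique.  This
-- holds for every w ∈ S, and for every w ∈ K with no neighbour in S.
-- An edge with an endpoint s ∈ S lies in N[s].  For an edge inside K we use
-- CIS: if no vertex of S were complete to K, then K would be a maximal
-- clique, and if no vertex of K were anticomplete to S, then S would be a
-- maximal stable set; these two disjoint sets would violate CIS.  So one
-- such vertex w exists, and K ⊆ N[w].  Finally, both CIS and splitness pass to the complement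
-- (cliques and stable sets swap roles), which gives the ∩-version.

open import Defs
open import Data.Nat using (ℕ)
open import Data.Fin using (Fin; _≟_)
open import Data.Fin.Subset using (Subset; _∈_; _⊆_)
open import Data.Fin.Subset.Properties using (_∈?_)
open import Data.Fin.Properties using (any?; all?)
open import Data.Bool using (true; false; not; _∨_)
import Data.Bool.Properties as Bool
open import Data.Vec using (tabulate)
open import Data.Vec.Properties using ([]=⇒lookup; lookup⇒[]=; lookup∘tabulate)
open import Data.Product using (∃; _×_; _,_; proj₂)
open import Data.Sum using (_⊎_; inj₁; inj₂; [_,_])
open import Data.Empty using (⊥; ⊥-elim)
open import Relation.Nullary using (¬_; yes; no)
open import Relation.Nullary.Decidable using (isYes; ¬?; _×-dec_; _→-dec_; decidable-stable)
open import Relation.Binary.PropositionalEquality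
  using (_≡_; _≢_; refl; trans; subst) renaming (sym to ≡-sym)
open import Function.Bundles using (_⇔_; mk⇔; Equivalence)

maximal-transfer : ∀ {n} {P Q : Subset n → Set} →
  (∀ X → P X → Q X) → (∀ X → Q X → P X) →
  ∀ X → P X × (∀ Y → P Y → X ⊆ Y → Y ⊆ X) → Q X × (∀ Y → Q Y → X ⊆ Y → Y ⊆ X)
maximal-transfer P⇒Q Q⇒P X (pX , maxX) =
  P⇒Q X pX , λ Y qY X⊆Y → maxX Y (Q⇒P Y qY) X⊆Y

not≡true⇔ : ∀ b → (not b ≡ true) ⇔ (¬ b ≡ true)
not≡true⇔ false = mk⇔ (λ _ ()) (λ _ → refl)
not≡true⇔ true  = mk⇔ (λ ()) (λ ¬t → ⊥-elim (¬t refl))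

module _ {n : ℕ} (G : Graph n) where

  closedNbhd : Fin n → Subset n
  closedNbhd w = tabulate λ x → isYes (x ≟ w) ∨ adj G w x

  ∈closedNbhd⇔ : ∀ w x → x ∈ closedNbhd w ⇔ InClosedNbhd G w x
  ∈closedNbhd⇔ w x = mk⇔
    (λ x∈ → fromBool (trans (≡-sym (lookup∘tabulate _ x)) ([]=⇒lookup x∈)))
    (λ h → lookup⇒[]= x (closedNbhd w) (trans (lookup∘tabulate _ x) (toBool h)))
    where
    fromBool : isYes (x ≟ w) ∨ adj G w x ≡ true → InClosedNbhd G w x
    fromBool e with x ≟ w
    ... | yes x≡w = inj₁ x≡w
    ... | no _    = inj₂ e

    toBool : InClosedNbhd G w x → isYes (x ≟ w) ∨ adj G w x ≡ true
    toBool h with x ≟ w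
    toBool _          | yes _ = refl
    toBool (inj₁ x≡w) | no x≢w = ⊥-elim (x≢w x≡w)
    toBool (inj₂ a)   | no _   = a

  NbhdWithin : Subset n → Fin n → Set
  NbhdWithin K w = ∀ x → Adj G w x → x ∈ K

  EdgeCovered : Fin n → Fin n → Set
  EdgeCovered u v = ∃ λ C → IsSimplicialClique G C × u ∈ C × v ∈ C

  closedNbhd-simplicial : ∀ K w → IsClique G K → NbhdWithin K w →
                          IsSimplicialClique G (closedNbhd w)
  closedNbhd-simplicial K w cK within =
    isClique , w , ∈closedNbhd⇔ w
    where
    isClique : IsClique G (closedNbhd w)
    isClique x y x∈ y∈ x≢y
      with Equivalence.to (∈closedNbhd⇔ w x) x∈ | Equivalence.to (∈closedNbhd⇔ w y) y∈
    ... | inj₁ refl | inj₁ refl = ⊥-elim (x≢y refl)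
    ... | inj₁ refl | inj₂ wy   = wy
    ... | inj₂ wx   | inj₁ refl = trans (Graph.sym G x w) wx
    ... | inj₂ wx   | inj₂ wy   = cK x y (within x wx) (within y wy) x≢y

  edge-in-closedNbhd : ∀ K w → IsClique G K → NbhdWithin K w →
    ∀ u v → InClosedNbhd G w u → InClosedNbhd G w v → EdgeCovered u v
  edge-in-closedNbhd K w cK within u v wu wv =
    closedNbhd w , closedNbhd-simplicial K w cK within ,
    Equivalence.from (∈closedNbhd⇔ w u) wu , Equivalence.from (∈closedNbhd⇔ w v) wv

  module SplitPartition
    (K S : Subset n) (cK : IsClique G K) (sS : IsStable G S)
    (cover : ∀ v → v ∈ K ⊎ v ∈ S) (disjoint : ∀ v → v ∈ K → v ∈ S → ⊥) where

    CompleteToK : Fin n → Set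
    CompleteToK s = ∀ k → k ∈ K → Adj G s k

    AnticompleteToS : Fin n → Set
    AnticompleteToS k = ∀ x → x ∈ S → ¬ Adj G k x

    stable-nbhd-within : ∀ s → s ∈ S → NbhdWithin K s
    stable-nbhd-within s s∈S x sx = [ (λ x∈K → x∈K) , (λ x∈S → ⊥-elim (sS s x s∈S x∈S sx)) ] (cover x)

    anticomplete-nbhd-within : ∀ k → AnticompleteToS k → NbhdWithin K k
    anticomplete-nbhd-within k anti x kx = [ (λ x∈K → x∈K) , (λ x∈S → ⊥-elim (anti x x∈S kx)) ] (cover x)

    clique-closedNbhd : ∀ k x → k ∈ K → x ∈ K → InClosedNbhd G k x
    clique-closedNbhd k x k∈K x∈K with x ≟ k
    ... | yes x≡k = inj₁ x≡k
    ... | no x≢k  = inj₂ (cK k x k∈K x∈K (λ k≡x → x≢k (≡-sym k≡x)))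

    -- K can only be enlarged to a clique by a vertex of S complete to K.
    K-maximal : ¬ (∃ λ s → s ∈ S × CompleteToK s) → IsMaximalClique G K
    K-maximal noComplete = cK , λ K′ cK′ K⊆K′ {x} x∈K′ →
      [ (λ x∈K → x∈K) , (λ x∈S → ⊥-elim (noComplete (x , x∈S , complete K′ cK′ K⊆K′ x x∈K′ x∈S))) ] (cover x)
      where
      complete : ∀ K′ → IsClique G K′ → K ⊆ K′ → ∀ x → x ∈ K′ → x ∈ S → CompleteToK x
      complete K′ cK′ K⊆K′ x x∈K′ x∈S k k∈K =
        cK′ x k x∈K′ (K⊆K′ k∈K) (λ x≡k → disjoint k k∈K (subst (_∈ S) x≡k x∈S))

    -- S can only be enlarged to a stable set by a vertex of K anticomplete to S.
    S-maximal : ¬ (∃ λ k → k ∈ K × AnticompleteToS k) → IsMaximalStable G S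
    S-maximal noAnticomplete = sS , λ S′ sS′ S⊆S′ {x} x∈S′ →
      [ (λ x∈K → ⊥-elim (noAnticomplete (x , x∈K , λ y y∈S → sS′ x y x∈S′ (S⊆S′ y∈S)))) , (λ x∈S → x∈S) ] (cover x)

    -- Under CIS, some vertex of S is complete to K or some vertex of K is
    -- anticomplete to S; otherwise the disjoint sets K and S are a maximal
    -- clique and a maximal stable set.
    cis-dichotomy : IsCIS G →
      (∃ λ s → s ∈ S × CompleteToK s) ⊎ (∃ λ k → k ∈ K × AnticompleteToS k)
    cis-dichotomy cis with any? (λ s → (s ∈? S) ×-dec all? (λ k → (k ∈? K) →-dec (adj G s k Bool.≟ true)))
    ... | yes complete = inj₁ complete
    ... | no noComplete
      with any? (λ k → (k ∈? K) ×-dec all? (λ x → (x ∈? S) →-dec ¬? (adj G k x Bool.≟ true)))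
    ...   | yes anticomplete = inj₂ anticomplete
    ...   | no noAnticomplete with cis K S (K-maximal noComplete) (S-maximal noAnticomplete)
    ...     | w , w∈K , w∈S = ⊥-elim (disjoint w w∈K w∈S)

    edge-simplicial : IsCIS G → IsEdgeSimplicial G
    edge-simplicial cis u v uv = cases (cover u) (cover v)
      where
      vu : Adj G v u
      vu = trans (Graph.sym G v u) uv

      cases : u ∈ K ⊎ u ∈ S → v ∈ K ⊎ v ∈ S → EdgeCovered u v
      cases (inj₂ u∈S) (inj₂ v∈S) = ⊥-elim (sS u v u∈S v∈S uv)
      cases (inj₂ u∈S) (inj₁ _) =
        edge-in-closedNbhd K u cK (stable-nbhd-within u u∈S) u v (inj₁ refl) (inj₂ uv)
      cases (inj₁ _) (inj₂ v∈S) =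
        edge-in-closedNbhd K v cK (stable-nbhd-within v v∈S) u v (inj₂ vu) (inj₁ refl)
      cases (inj₁ u∈K) (inj₁ v∈K) with cis-dichotomy cis
      ... | inj₁ (s , s∈S , complete) =
        edge-in-closedNbhd K s cK (stable-nbhd-within s s∈S) u v
          (inj₂ (complete u u∈K)) (inj₂ (complete v v∈K))
      ... | inj₂ (k , k∈K , anti) =
        edge-in-closedNbhd K k cK (anticomplete-nbhd-within k anti) u v
          (clique-closedNbhd k u k∈K u∈K) (clique-closedNbhd k v k∈K v∈K)

  cis-split⇒edge-simplicial : IsCIS G → IsSplit G → IsEdgeSimplicial G
  cis-split⇒edge-simplicial cis (K , S , cK , sS , cover , disjoint) =
    SplitPartition.edge-simplicial K S cK sS cover disjoint cis

  complement-adj⇔ : ∀ u v → Adj (complement G) u v ⇔ (u ≢ v × ¬ Adj G u v)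
  complement-adj⇔ u v with u ≟ v
  ... | yes u≡v = mk⇔ (λ ()) (λ (u≢v , _) → ⊥-elim (u≢v u≡v))
  ... | no u≢v  = mk⇔ (λ e → u≢v , Equivalence.to (not≡true⇔ (adj G u v)) e)
                      (λ (_ , ¬uv) → Equivalence.from (not≡true⇔ (adj G u v)) ¬uv)

  stable⇒complement-clique : ∀ X → IsStable G X → IsClique (complement G) X
  stable⇒complement-clique X sX u v u∈X v∈X u≢v =
    Equivalence.from (complement-adj⇔ u v) (u≢v , sX u v u∈X v∈X)

  complement-clique⇒stable : ∀ X → IsClique (complement G) X → IsStable G X
  complement-clique⇒stable X cX u v u∈X v∈X uv with u ≟ v
  ... | yes refl = Bool.not-¬ (Graph.irrefl G u) uv
  ... | no u≢v   = Equivalence.to (complement-adj⇔ u v) (cX u v u∈X v∈X u≢v) .proj₂ uv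

  clique⇒complement-stable : ∀ X → IsClique G X → IsStable (complement G) X
  clique⇒complement-stable X cX u v u∈X v∈X ūv with Equivalence.to (complement-adj⇔ u v) ūv
  ... | u≢v , ¬uv = ¬uv (cX u v u∈X v∈X u≢v)

  complement-stable⇒clique : ∀ X → IsStable (complement G) X → IsClique G X
  complement-stable⇒clique X sX u v u∈X v∈X u≢v =
    decidable-stable (adj G u v Bool.≟ true)
      (λ ¬uv → sX u v u∈X v∈X (Equivalence.from (complement-adj⇔ u v) (u≢v , ¬uv)))

  complement-CIS : IsCIS G → IsCIS (complement G)
  complement-CIS cis K S maxK maxS with cis S K maxS′ maxK′
    where
    maxS′ : IsMaximalClique G S
    maxS′ = maximal-transfer complement-stable⇒clique clique⇒complement-stable S maxS
    maxK′ : IsMaximalStable G K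
    maxK′ = maximal-transfer complement-clique⇒stable stable⇒complement-clique K maxK
  ... | w , w∈S , w∈K = w , w∈K , w∈S

  complement-split : IsSplit G → IsSplit (complement G)
  complement-split (K , S , cK , sS , cover , disjoint) =
    S , K , stable⇒complement-clique S sS , clique⇒complement-stable K cK ,
    (λ v → [ inj₂ , inj₁ ] (cover v)) , (λ v v∈S v∈K → disjoint v v∈K v∈S)

proposition26 : ∀ (n : ℕ) (G : Graph n) → IsCIS G → IsSplit G → IsCapEdgeSimplicial G
proposition26 n G cis split =
  cis-split⇒edge-simplicial G cis split ,
  cis-split⇒edge-simplicial (complement G) (complement-CIS G cis) (complement-split G split)
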